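{- Let $a$ be a positive integer, $n=a^2+1$, and let $(A,B)$ be an $(n,2,a;1)$-SEDF in $\mathbb{Z}_n$ which is symmetric, i.e., $A=-A$ and $B=-B$. For $x\in\mathbb{Z}_n$ let $P_x=\{x,-x\}$. (1) If $a$ is odd, then either $P_0\subseteq A$ and $P_{(a^2+1)/2}\subseteq B$, or $P_0\subseteq B$ and $P_{(a^2+1)/2}\subseteq A$; all other sets $P_x$ contained in $A$ or in $B$ have cardinality two. (2) If $a$ is even, then $A$ and $B$ are both unions of sets $P_x$ of cardinality two.
   Context: For disjoint subsets $A,B$ of $\mathbb{Z}_n$, $\mathcal{D}(B,A)$ is the multiset $\{y-x: y\in B, x\in A\}$. An $(n,2,a;1)$-SEDF in $\mathbb{Z}_n$ is a pair $(A,B)$ of disjoint $a$-subsets of $\mathbb{Z}_n$ such that $\mathcal{D}(A,B)$ and $\mathcal{D}(B,A)$ each contain every nonzero element of $\mathbb{Z}_n$ exactly once. Note $|P_x|=1$ exactly when $x=0$ or ($a$ odd and $x=(a^2+1)/2$); a symmetric set is a union of sets $P_x$. -}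

module Defs where

open import Data.Nat using (ℕ; suc; _+_; _*_; _∸_; _/_; _%_; _≤_)
open import Data.Nat.DivMod using (_mod_)
open import Data.Fin using (Fin; toℕ; zero)
open import Data.Fin.Subset using (Subset; _∈_; ∣_∣; ⁅_⁆; _∪_; _⊆_)
open import Data.Fin.Subset.Properties using (_∈?_)
open import Data.Fin.Properties using (_≟_)
open import Data.List using (List; length; filter; allFin; concatMap; [_])
open import Data.Product using (_×_; _,_; proj₁)
open import Relation.Nullary using (¬_; Dec)
open import Relation.Binary.PropositionalEquality using (_≡_)

modulus : ℕ → ℕ
modulus a = suc (a * a)

Zn : ℕ → Set
Zn a = Fin (modulus a)

neg : ∀ {a} → Zn a → Zn a
neg {a} x = (modulus a ∸ toℕ x) mod modulus a

sub : ∀ {a} → Zn a → Zn a → Zn a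
sub {a} y x = (toℕ y + (modulus a ∸ toℕ x)) mod modulus a

half : ∀ a → Zn a
half a = (modulus a / 2) mod modulus a

-- number of pairs (y , x) with y ∈ Y, x ∈ X and y - x = d,
-- i.e. the multiplicity of d in the multiset D(Y,X) = {y - x : y ∈ Y, x ∈ X}
mult : ∀ {a} → Subset (modulus a) → Subset (modulus a) → Zn a → ℕ
mult {a} Y X d =
  length (filter (λ p → sub {a} (proj₁ p) (Data.Product.proj₂ p) ≟ d)
    (concatMap (λ y → concatMap (λ x → [ (y , x) ])
                        (filter (_∈? X) (allFin (modulus a))))
               (filter (_∈? Y) (allFin (modulus a)))))

Disjoint : ∀ {m} → Subset m → Subset m → Set
Disjoint A B = ∀ x → x ∈ A → ¬ (x ∈ B)

IsSEDF : ∀ a → Subset (modulus a) → Subset (modulus a) → Set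
IsSEDF a A B =
  Disjoint A B × ∣ A ∣ ≡ a × ∣ B ∣ ≡ a ×
  (∀ d → ¬ (d ≡ zero) → mult {a} A B d ≡ 1) ×
  (∀ d → ¬ (d ≡ zero) → mult {a} B A d ≡ 1)

-- X = -X (given as closure under negation; neg is an involution)
Symmetric : ∀ {a} → Subset (modulus a) → Set
Symmetric {a} X = ∀ x → x ∈ X → neg {a} x ∈ X

P : ∀ {a} → Zn a → Subset (modulus a)
P {a} x = ⁅ x ⁆ ∪ ⁅ neg {a} x ⁆

{-# OPTIONS --safe #-}
-- Negation is an involution of ℤ_n whose fixed points are 0 and, when n = a² + 1 is
-- even, n / 2.  A set closed under an involution is its fixed points plus two-element
-- orbits, so a symmetric a-set contains a fixed point when a is odd, and disjointness
-- gives one to A and the other to B.  When a is even, n is odd, 0 is the only fixed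
-- point, and a symmetric set of even size cannot contain it.
module Submission where

open import Defs
open import Function using (_∘_)
open import Data.Nat using (ℕ; suc; _+_; _*_; _∸_; _/_; _%_; _≤_; _<_; z<s; s≤s)
open import Data.Nat.Properties using (suc-injective; +-comm; +-identityʳ; *-comm; <⇒≤; m∸n≤m; m∸[m∸n]≡n; m∸n+n≡m; m<n⇒0<n∸m)
open import Data.Nat.DivMod using (n%n≡0; m<n⇒m%n≡m; m*n/n≡m; /-congˡ)
open import Data.Nat.Divisibility using (_∣_; _∣0; ∣-refl; ∣m∣n⇒∣m+n; ∣m+n∣m⇒∣n; ∣1⇒≡1; m∣m*n; ∣m⇒∣m*n; m%n≡0⇒n∣m; n∣m⇒m%n≡0)
open import Data.Fin using (Fin; zero; suc; toℕ)
open import Data.Fin.Properties using (toℕ-fromℕ<; toℕ-injective; toℕ<n; any?; _≟_)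
open import Data.Fin.Subset using (Subset; inside; outside; _∈_; _∉_; _⊆_; ∣_∣; ⁅_⁆; _∪_; _-_; Nonempty)
open import Data.Fin.Subset.Properties using (x∈p∧x≢y⇒x∈p-y; p─q⊆p; p─q─q≡p─q; p─⊥≡p; x∈p∪q⁻; x∈⁅y⁆⇒x≡y; ∣⁅x⁆∣≡1; ∪-identityˡ; ∪-identityʳ; _∈?_)
open import Data.Vec using (_∷_; here; there)
open import Data.Product as × using (_×_; _,_; ∃)
open import Data.Sum as ⊎ using (_⊎_; inj₁; inj₂; [_,_]′)
open import Relation.Nullary using (¬_; yes; no; contradiction)
open import Relation.Nullary.Decidable using (_×-dec_)
open import Relation.Binary.PropositionalEquality using (_≡_; _≢_; refl; sym; trans; cong; subst; ≢-sym; module ≡-Reasoning)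

x∈p⇒∣p∣≡1+∣p-x∣ : ∀ {m} {p : Subset m} {x} → x ∈ p → ∣ p ∣ ≡ suc ∣ p - x ∣
x∈p⇒∣p∣≡1+∣p-x∣ {p = inside ∷ p} here = cong (suc ∘ ∣_∣) (sym (p─⊥≡p p))
x∈p⇒∣p∣≡1+∣p-x∣ {p = inside ∷ p} (there x∈p) = cong suc (x∈p⇒∣p∣≡1+∣p-x∣ x∈p)
x∈p⇒∣p∣≡1+∣p-x∣ {p = outside ∷ p} (there x∈p) = x∈p⇒∣p∣≡1+∣p-x∣ x∈p

x∉p-x : ∀ {m} (p : Subset m) x → x ∉ p - x
x∉p-x (inside ∷ p) zero ()
x∉p-x (outside ∷ p) zero ()
x∉p-x (_ ∷ p) (suc x) (there x∈p-x) = x∉p-x p x x∈p-x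

x∈p-y⇒x≢y : ∀ {m} {p : Subset m} {x y} → x ∈ p - y → x ≢ y
x∈p-y⇒x≢y x∈p-x refl = x∉p-x _ _ x∈p-x

∣p∣≡1+n⇒Nonempty : ∀ {m n} {p : Subset m} → ∣ p ∣ ≡ suc n → Nonempty p
∣p∣≡1+n⇒Nonempty {p = inside ∷ p} _ = zero , here
∣p∣≡1+n⇒Nonempty {p = outside ∷ p} ∣p∣≡1+n with x , x∈p ← ∣p∣≡1+n⇒Nonempty ∣p∣≡1+n =
  suc x , there x∈p

x≢y⇒∣⁅x⁆∪⁅y⁆∣≡2 : ∀ {m} {x y : Fin m} → x ≢ y → ∣ ⁅ x ⁆ ∪ ⁅ y ⁆ ∣ ≡ 2
x≢y⇒∣⁅x⁆∪⁅y⁆∣≡2 {x = zero} {zero} x≢y = contradiction refl x≢y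
x≢y⇒∣⁅x⁆∪⁅y⁆∣≡2 {x = zero} {suc y} _ = cong suc (trans (cong ∣_∣ (∪-identityˡ ⁅ y ⁆)) (∣⁅x⁆∣≡1 y))
x≢y⇒∣⁅x⁆∪⁅y⁆∣≡2 {x = suc x} {zero} _ = cong suc (trans (cong ∣_∣ (∪-identityʳ ⁅ x ⁆)) (∣⁅x⁆∣≡1 x))
x≢y⇒∣⁅x⁆∪⁅y⁆∣≡2 {x = suc x} {suc y} x≢y = x≢y⇒∣⁅x⁆∪⁅y⁆∣≡2 (x≢y ∘ cong suc)

x∈p∧y∈p⇒⁅x⁆∪⁅y⁆⊆p : ∀ {m} {p : Subset m} {x y} → x ∈ p → y ∈ p → ⁅ x ⁆ ∪ ⁅ y ⁆ ⊆ p
x∈p∧y∈p⇒⁅x⁆∪⁅y⁆⊆p {p = p} {x} {y} x∈p y∈p z∈⁅x⁆∪⁅y⁆ =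
  [ (λ z∈⁅x⁆ → subst (_∈ p) (sym (x∈⁅y⁆⇒x≡y x z∈⁅x⁆)) x∈p)
  , (λ z∈⁅y⁆ → subst (_∈ p) (sym (x∈⁅y⁆⇒x≡y y z∈⁅y⁆)) y∈p)
  ]′ (x∈p∪q⁻ ⁅ x ⁆ ⁅ y ⁆ z∈⁅x⁆∪⁅y⁆)

disjoint⇒split : ∀ {m} {p q : Subset m} {x y} → Disjoint p q →
                  x ∈ p ⊎ y ∈ p → x ∈ q ⊎ y ∈ q → (x ∈ p × y ∈ q) ⊎ (x ∈ q × y ∈ p)
disjoint⇒split disjoint (inj₁ x∈p) (inj₁ x∈q) = contradiction x∈q (disjoint _ x∈p)
disjoint⇒split _ (inj₁ x∈p) (inj₂ y∈q) = inj₁ (x∈p , y∈q)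
disjoint⇒split _ (inj₂ y∈p) (inj₁ x∈q) = inj₂ (x∈q , y∈p)
disjoint⇒split disjoint (inj₂ y∈p) (inj₂ y∈q) = contradiction y∈q (disjoint _ y∈p)

2∣m⇒2∤1+m : ∀ {m} → 2 ∣ m → ¬ 2 ∣ suc m
2∣m⇒2∤1+m {m} 2∣m 2∣1+m with () ← ∣1⇒≡1 (∣m+n∣m⇒∣n (subst (2 ∣_) (+-comm 1 m) 2∣1+m) 2∣m)

2∣m+m : ∀ m → 2 ∣ m + m
2∣m+m m = subst (λ k → 2 ∣ m + k) (+-identityʳ m) (m∣m*n m)

module Involution {m} (f : Fin m → Fin m) (f-involutive : ∀ x → f (f x) ≡ x) where

  Closed : Subset m → Set
  Closed X = ∀ x → x ∈ X → f x ∈ X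

  FixedPointFree : Subset m → Set
  FixedPointFree X = ∀ x → x ∈ X → f x ≢ x

  f-flip : ∀ {x y} → f x ≡ y → x ≡ f y
  f-flip {x} refl = sym (f-involutive x)

  closed⇒closed-minus-orbit : ∀ {X} x → Closed X → Closed (X - x - f x)
  closed⇒closed-minus-orbit {X} x closed z z∈X-x-fx =
    x∈p∧x≢y⇒x∈p-y (x∈p∧x≢y⇒x∈p-y (closed z z∈X) fz≢x) fz≢fx
    where
    z∈X-x : z ∈ X - x
    z∈X-x = p─q⊆p (X - x) ⁅ f x ⁆ z∈X-x-fx
    z∈X : z ∈ X
    z∈X = p─q⊆p X ⁅ x ⁆ z∈X-x
    fz≢x : f z ≢ x
    fz≢x = x∈p-y⇒x≢y z∈X-x-fx ∘ f-flip
    fz≢fx : f z ≢ f x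
    fz≢fx fz≡fx = x∈p-y⇒x≢y z∈X-x (trans (f-flip fz≡fx) (f-involutive x))

  closed⇒closed-minus-fixed : ∀ {X x} → f x ≡ x → Closed X → Closed (X - x)
  closed⇒closed-minus-fixed {X} {x} fx≡x closed =
    subst Closed (trans (cong (X - x -_) fx≡x) (p─q─q≡p─q X ⁅ x ⁆))
      (closed⇒closed-minus-orbit x closed)

  ∣X∣≡2+∣X-orbit∣ : ∀ {X x} → Closed X → FixedPointFree X → x ∈ X →
                    ∣ X ∣ ≡ 2 + ∣ X - x - f x ∣
  ∣X∣≡2+∣X-orbit∣ {X} {x} closed fpf x∈X =
    trans (x∈p⇒∣p∣≡1+∣p-x∣ x∈X) (cong suc (x∈p⇒∣p∣≡1+∣p-x∣ fx∈X-x))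
    where
    fx∈X-x : f x ∈ X - x
    fx∈X-x = x∈p∧x≢y⇒x∈p-y (closed x x∈X) (fpf x x∈X)

  closed∧fixedPointFree⇒2∣∣X∣ : ∀ {X} → Closed X → FixedPointFree X → 2 ∣ ∣ X ∣
  closed∧fixedPointFree⇒2∣∣X∣ = go _ refl
    where
    go : ∀ k {X} → ∣ X ∣ ≡ k → Closed X → FixedPointFree X → 2 ∣ k
    go 0 _ _ _ = 2 ∣0
    go (suc k) ∣X∣≡1+k closed fpf with ∣p∣≡1+n⇒Nonempty ∣X∣≡1+k
    ... | x , x∈X with trans (sym ∣X∣≡1+k) (∣X∣≡2+∣X-orbit∣ closed fpf x∈X)
    go 1 _ _ _ | _ | ()
    go (suc (suc k)) _ closed fpf | x , _ | 2+k≡2+∣X-orbit∣ =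
      ∣m∣n⇒∣m+n ∣-refl (go k (sym (suc-injective (suc-injective 2+k≡2+∣X-orbit∣)))
        (closed⇒closed-minus-orbit x closed)
        (λ z z∈X-orbit → fpf z (p─q⊆p _ _ (p─q⊆p _ _ z∈X-orbit))))

  closed∧2∤∣X∣⇒fixed-point : ∀ {X} → Closed X → ¬ 2 ∣ ∣ X ∣ → ∃ λ x → x ∈ X × f x ≡ x
  closed∧2∤∣X∣⇒fixed-point {X} closed 2∤∣X∣ with any? (λ x → x ∈? X ×-dec f x ≟ x)
  ... | yes fixed-point = fixed-point
  ... | no ¬fixed-point = contradiction
    (closed∧fixedPointFree⇒2∣∣X∣ closed (λ x x∈X fx≡x → ¬fixed-point (x , x∈X , fx≡x))) 2∤∣X∣

  unique-fixed-point∈closed⇒2∤∣X∣ : ∀ {X x} → f x ≡ x → (∀ y → f y ≡ y → y ≡ x) →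
                                   Closed X → x ∈ X → ¬ 2 ∣ ∣ X ∣
  unique-fixed-point∈closed⇒2∤∣X∣ {X} {x} fx≡x unique closed x∈X 2∣∣X∣ =
    2∣m⇒2∤1+m 2∣∣X-x∣ (subst (2 ∣_) (x∈p⇒∣p∣≡1+∣p-x∣ x∈X) 2∣∣X∣)
    where
    2∣∣X-x∣ : 2 ∣ ∣ X - x ∣
    2∣∣X-x∣ = closed∧fixedPointFree⇒2∣∣X∣
      (closed⇒closed-minus-fixed fx≡x closed)
      (λ y y∈X-x fy≡y → x∈p-y⇒x≢y y∈X-x (unique y fy≡y))

module Negation (a : ℕ) where

  open ≡-Reasoning

  private
    n : ℕ
    n = modulus a

  toℕ-neg : ∀ x → toℕ (neg {a} x) ≡ (n ∸ toℕ x) % n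
  toℕ-neg x = toℕ-fromℕ< _

  neg-zero : neg {a} zero ≡ zero
  neg-zero = toℕ-injective (trans (toℕ-neg zero) (n%n≡0 n))

  toℕ-neg-pos : ∀ x → 0 < toℕ x → toℕ (neg {a} x) ≡ n ∸ toℕ x
  toℕ-neg-pos (suc x) _ = trans (toℕ-neg (suc x)) (m<n⇒m%n≡m (s≤s (m∸n≤m (a * a) (toℕ x))))

  neg-involutive : ∀ x → neg {a} (neg {a} x) ≡ x
  neg-involutive zero = trans (cong (neg {a}) neg-zero) neg-zero
  neg-involutive (suc x) = toℕ-injective (begin
    toℕ (neg {a} (neg {a} (suc x)))  ≡⟨ toℕ-neg-pos (neg {a} (suc x)) 0<toℕ-neg ⟩
    n ∸ toℕ (neg {a} (suc x))        ≡⟨ cong (n ∸_) (toℕ-neg-pos (suc x) z<s) ⟩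
    n ∸ (n ∸ suc (toℕ x))            ≡⟨ m∸[m∸n]≡n (<⇒≤ (toℕ<n (suc x))) ⟩
    suc (toℕ x)                      ∎)
    where
    0<toℕ-neg : 0 < toℕ (neg {a} (suc x))
    0<toℕ-neg = subst (0 <_) (sym (toℕ-neg-pos (suc x) z<s)) (m<n⇒0<n∸m (toℕ<n (suc x)))

  neg-fixed⇒zero⊎double≡n : ∀ x → neg {a} x ≡ x → x ≡ zero ⊎ toℕ x + toℕ x ≡ n
  neg-fixed⇒zero⊎double≡n zero _ = inj₁ refl
  neg-fixed⇒zero⊎double≡n (suc x) fixed = inj₂ (begin
    toℕ (suc x) + toℕ (suc x)            ≡⟨ cong (_+ toℕ (suc x)) (cong toℕ fixed) ⟨
    toℕ (neg {a} (suc x)) + toℕ (suc x)  ≡⟨ cong (_+ toℕ (suc x)) (toℕ-neg-pos (suc x) z<s) ⟩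
    n ∸ toℕ (suc x) + toℕ (suc x)        ≡⟨ m∸n+n≡m (<⇒≤ (toℕ<n (suc x))) ⟩
    n                                    ∎)

  double≡n⇒≡half : ∀ x → toℕ x + toℕ x ≡ n → x ≡ half a
  double≡n⇒≡half x double≡n = toℕ-injective (sym (begin
    toℕ (half a)  ≡⟨ toℕ-fromℕ< _ ⟩
    n / 2 % n     ≡⟨ cong (_% n) n/2≡x ⟩
    toℕ x % n     ≡⟨ m<n⇒m%n≡m (toℕ<n x) ⟩
    toℕ x         ∎))
    where
    n/2≡x : n / 2 ≡ toℕ x
    n/2≡x = begin
      n / 2                ≡⟨ /-congˡ (sym double≡n) ⟩
      (toℕ x + toℕ x) / 2  ≡⟨ /-congˡ (cong (toℕ x +_) (sym (+-identityʳ (toℕ x)))) ⟩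
      2 * toℕ x / 2        ≡⟨ /-congˡ (*-comm 2 (toℕ x)) ⟩
      toℕ x * 2 / 2        ≡⟨ m*n/n≡m (toℕ x) 2 ⟩
      toℕ x                ∎

  neg-fixed⇒zero⊎half : ∀ x → neg {a} x ≡ x → x ≡ zero ⊎ x ≡ half a
  neg-fixed⇒zero⊎half x fixed with neg-fixed⇒zero⊎double≡n x fixed
  ... | inj₁ x≡0 = inj₁ x≡0
  ... | inj₂ double≡n = inj₂ (double≡n⇒≡half x double≡n)

  2∣a∧neg-fixed⇒zero : 2 ∣ a → ∀ x → neg {a} x ≡ x → x ≡ zero
  2∣a∧neg-fixed⇒zero 2∣a x fixed with neg-fixed⇒zero⊎double≡n x fixed
  ... | inj₁ x≡0 = x≡0
  ... | inj₂ double≡n =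
    contradiction (subst (2 ∣_) double≡n (2∣m+m (toℕ x))) (2∣m⇒2∤1+m (∣m⇒∣m*n a 2∣a))

  open Involution (neg {a}) neg-involutive

  P⊆symmetric : ∀ {X x} → Symmetric {a} X → x ∈ X → P {a} x ⊆ X
  P⊆symmetric symmetric x∈X = x∈p∧y∈p⇒⁅x⁆∪⁅y⁆⊆p x∈X (symmetric _ x∈X)

  ∣P∣≡2 : ∀ {x} → neg {a} x ≢ x → ∣ P {a} x ∣ ≡ 2
  ∣P∣≡2 = x≢y⇒∣⁅x⁆∪⁅y⁆∣≡2 ∘ ≢-sym

  P≢P0∧P≢Phalf⇒∣P∣≡2 : ∀ {x} → P {a} x ≢ P {a} zero → P {a} x ≢ P {a} (half a) →
                       ∣ P {a} x ∣ ≡ 2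
  P≢P0∧P≢Phalf⇒∣P∣≡2 {x} Px≢P0 Px≢Phalf =
    ∣P∣≡2 ([ Px≢P0 ∘ cong (P {a}) , Px≢Phalf ∘ cong (P {a}) ]′ ∘ neg-fixed⇒zero⊎half x)

  symmetric∧2∤∣X∣⇒zero∈⊎half∈ : ∀ {X} → Symmetric {a} X → ¬ 2 ∣ ∣ X ∣ →
                                zero ∈ X ⊎ half a ∈ X
  symmetric∧2∤∣X∣⇒zero∈⊎half∈ {X} symmetric 2∤∣X∣
    with x , x∈X , fixed ← closed∧2∤∣X∣⇒fixed-point symmetric 2∤∣X∣
    with neg-fixed⇒zero⊎half x fixed
  ... | inj₁ refl = inj₁ x∈X
  ... | inj₂ refl = inj₂ x∈X

  2∣a∧symmetric∧2∣∣X∣⇒∣P∣≡2 : ∀ {X x} → 2 ∣ a → Symmetric {a} X → 2 ∣ ∣ X ∣ → x ∈ X →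
                              ∣ P {a} x ∣ ≡ 2
  2∣a∧symmetric∧2∣∣X∣⇒∣P∣≡2 {X} {x} 2∣a symmetric 2∣∣X∣ x∈X = ∣P∣≡2 λ fixed →
    unique-fixed-point∈closed⇒2∤∣X∣ neg-zero (2∣a∧neg-fixed⇒zero 2∣a) symmetric
      (subst (_∈ X) (2∣a∧neg-fixed⇒zero 2∣a x fixed) x∈X) 2∣∣X∣

lemma3p11 : (a : ℕ) → 1 ≤ a → (A B : Subset (modulus a)) →
    IsSEDF a A B → Symmetric {a} A → Symmetric {a} B →
    (a % 2 ≡ 1 →
      (((P {a} zero ⊆ A) × (P {a} (half a) ⊆ B)) ⊎ ((P {a} zero ⊆ B) × (P {a} (half a) ⊆ A)))
      × (∀ x → (P {a} x ⊆ A ⊎ P {a} x ⊆ B) →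
           ¬ (P {a} x ≡ P {a} zero) → ¬ (P {a} x ≡ P {a} (half a)) →
           ∣ P {a} x ∣ ≡ 2))
    × (a % 2 ≡ 0 →
      (∀ x → x ∈ A → ∣ P {a} x ∣ ≡ 2) × (∀ x → x ∈ B → ∣ P {a} x ∣ ≡ 2))
lemma3p11 a _ A B (disjoint , ∣A∣≡a , ∣B∣≡a , _ , _) symA symB =
    (λ a%2≡1 →
        ⊎.map (×.map (P⊆symmetric symA) (P⊆symmetric symB))
              (×.map (P⊆symmetric symB) (P⊆symmetric symA))
          (disjoint⇒split disjoint
            (symmetric∧2∤∣X∣⇒zero∈⊎half∈ symA (≡a∧odd⇒2∤ ∣A∣≡a a%2≡1))
            (symmetric∧2∤∣X∣⇒zero∈⊎half∈ symB (≡a∧odd⇒2∤ ∣B∣≡a a%2≡1)))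
      , λ _ _ → P≢P0∧P≢Phalf⇒∣P∣≡2)
  , (λ a%2≡0 →
        (λ _ → 2∣a∧symmetric∧2∣∣X∣⇒∣P∣≡2 (≡a∧even⇒2∣ refl a%2≡0) symA (≡a∧even⇒2∣ ∣A∣≡a a%2≡0))
      , (λ _ → 2∣a∧symmetric∧2∣∣X∣⇒∣P∣≡2 (≡a∧even⇒2∣ refl a%2≡0) symB (≡a∧even⇒2∣ ∣B∣≡a a%2≡0)))
  where
  open Negation a

  ≡a∧odd⇒2∤ : ∀ {k} → k ≡ a → a % 2 ≡ 1 → ¬ 2 ∣ k
  ≡a∧odd⇒2∤ refl a%2≡1 2∣a with () ← trans (sym (n∣m⇒m%n≡0 a 2 2∣a)) a%2≡1

  ≡a∧even⇒2∣ : ∀ {k} → k ≡ a → a % 2 ≡ 0 → 2 ∣ k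
  ≡a∧even⇒2∣ refl a%2≡0 = m%n≡0⇒n∣m a 2 a%2≡0
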